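{- Let $k$ be a field of characteristic $2$, $q=2^e$ with $e>1$, and $\mathrm{T}(X)=X^{q/2}+X^{q/4}+\dots+X$. Then in $k[Y,Z]$ (with $\omega$ ranging over the $q+1$ roots of $\omega^{q+1}=1$ in an algebraic closure of $k$), \[ \prod_{\omega^{q+1}=1}(\omega Y+1+\omega^{ -1}Z)=Y^{q+1}+Z^{q+1}+\mathrm{T}(YZ)+1. \] -}

module Defs where

open import Level using (Level; _⊔_; suc)
open import Data.Nat using (ℕ; zero; suc; _^_)
open import Data.List using (List; []; _∷_; map; foldr; upTo)
open import Algebra.Bundles using (CommutativeRing)
open import Relation.Nullary using (¬_)

-- A field: a commutative ring with 0 ≉ 1 in which every nonzero element
-- has a multiplicative inverse (given as a total function `inv`, whose value
-- at 0 is irrelevant).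
record Field (c ℓ : Level) : Set (Level.suc (c ⊔ ℓ)) where
  field
    commutativeRing : CommutativeRing c ℓ
  open CommutativeRing commutativeRing public
  field
    0≉1     : ¬ (0# ≈ 1#)
    inv     : Carrier → Carrier
    inverse : ∀ x → ¬ (x ≈ 0#) → (x * inv x) ≈ 1#

-- Univariate polynomials as coefficient lists (lowest degree first),
-- over any carrier with addition, multiplication and zero.
module UPoly {a} {A : Set a} (_⊕_ _⊗_ : A → A → A) (zero# : A) where
  addP : List A → List A → List A
  addP []       q        = q
  addP (x ∷ p)  []       = x ∷ p
  addP (x ∷ p)  (y ∷ q)  = (x ⊕ y) ∷ addP p q

  mulP : List A → List A → List A
  mulP []      q = []
  mulP (x ∷ p) q = addP (map (x ⊗_) q) (zero# ∷ mulP p q)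

  coeff : List A → ℕ → A
  coeff []      _       = zero#
  coeff (x ∷ p) zero    = x
  coeff (x ∷ p) (suc i) = coeff p i

-- Bivariate polynomials k[Y,Z] over a commutative ring:
-- an element is a list (indexed by the power of Y) of lists (indexed by the
-- power of Z) of coefficients.
module BiPoly {c ℓ} (R : CommutativeRing c ℓ) where
  open CommutativeRing R

  Poly2 : Set c
  Poly2 = List (List Carrier)

  module Inner = UPoly _+_ _*_ 0#
  module Outer = UPoly Inner.addP Inner.mulP []

  infixl 6 _+P_
  infixl 7 _*P_
  infix 4 _≈P_

  _+P_ : Poly2 → Poly2 → Poly2
  _+P_ = Outer.addP

  _*P_ : Poly2 → Poly2 → Poly2
  _*P_ = Outer.mulP

  coeff2 : Poly2 → ℕ → ℕ → Carrier
  coeff2 P i j = Inner.coeff (Outer.coeff P i) j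

  _≈P_ : Poly2 → Poly2 → Set ℓ
  P ≈P Q = ∀ i j → coeff2 P i j ≈ coeff2 Q i j

  const : Carrier → Poly2
  const a = (a ∷ []) ∷ []

  1P : Poly2
  1P = const 1#

  Y : Poly2
  Y = [] ∷ (1# ∷ []) ∷ []

  Z : Poly2
  Z = (0# ∷ 1# ∷ []) ∷ []

  _·_ : Carrier → Poly2 → Poly2
  a · P = map (map (a *_)) P

  _^P_ : Poly2 → ℕ → Poly2
  P ^P zero  = 1P
  P ^P suc n = P *P (P ^P n)

  sumP : List Poly2 → Poly2
  sumP = foldr _+P_ []

  prodP : List Poly2 → Poly2
  prodP = foldr _*P_ 1P

module RingPow {c ℓ} (R : CommutativeRing c ℓ) where
  open CommutativeRing R
  pow : Carrier → ℕ → Carrier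
  pow x zero    = 1#
  pow x (suc n) = x * pow x n

module Trace {c ℓ} (R : CommutativeRing c ℓ) where
  open BiPoly R
  T : ℕ → Poly2 → Poly2
  T e X = sumP (map (λ i → X ^P (2 ^ i)) (upTo e))

{-# OPTIONS --safe #-}
module Submission where

-- Write q = 2^e and n = q + 1. Multiplying the factor of ω by ωY gives
-- u² + u + YZ with u = ωY, and ∏ ω = 1, so Y^n times the product is
-- ∏ (u² + u + YZ). Over S = k[Y,Z] adjoin β with β² = β + YZ; in
-- characteristic 2, u² + u + YZ = (β + u)(β + 1 + u). Since the ω are the
-- n roots of X^n - 1 in k, homogenising X^n - 1 = ∏ (X - ω) gives
-- ∏ (a + ωY) = a^n + Y^n for every a, so the product becomes
-- (β^n + Y^n)((β + 1)^n + Y^n) = Y^n (Y^n + β^n + (β + 1)^n) + (β(β + 1))^n.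
-- Here β(β + 1) = YZ, and squaring β² = β + YZ repeatedly telescopes to
-- β^q = β + T(YZ), whence β^n + (β + 1)^n = T(YZ) + 1. Cancelling Y^n
-- gives the identity.

open import Defs
open import Algebra.Bundles using (CommutativeRing; CommutativeSemiring)
open import Algebra.Morphism.Structures using (IsRingHomomorphism)
import Algebra.Morphism.Construct.Composition as Composition
import Algebra.Properties.CommutativeSemiring.Exp as Exp
import Algebra.Properties.Group as GroupProperties
import Algebra.Properties.Ring as RingProperties
import Algebra.Solver.Ring.NaturalCoefficients.Default as Solver
open import Data.List using (List; []; _∷_; length; map; foldr; drop; applyUpTo; upTo)
import Data.List.Properties as List
open import Data.List.Relation.Unary.All using (All; []; _∷_)
import Data.List.Relation.Unary.All as All
open import Data.List.Relation.Unary.AllPairs using (AllPairs; []; _∷_)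
open import Data.Nat using (ℕ; zero; suc; _<_)
import Data.Nat as ℕ
import Data.Nat.Properties as ℕ
open import Data.Product using (_×_; _,_; proj₁; proj₂)
open import Function using (_∘_; id)
open import Relation.Binary.Structures using (IsEquivalence)
import Relation.Binary.Reasoning.Setoid as SetoidReasoning
open import Relation.Binary.PropositionalEquality as ≡ using (_≡_)
open import Relation.Nullary using (¬_)

module _ {c₁ ℓ₁ c₂ ℓ₂} (R₁ : CommutativeRing c₁ ℓ₁) (R₂ : CommutativeRing c₂ ℓ₂) where
  private
    module R₁ = CommutativeRing R₁
    module R₂ = CommutativeRing R₂

  mkIsRingHomomorphism : (f : R₁.Carrier → R₂.Carrier) →
    (∀ {x y} → x R₁.≈ y → f x R₂.≈ f y) →
    (∀ x y → f (x R₁.+ y) R₂.≈ f x R₂.+ f y) → f R₁.0# R₂.≈ R₂.0# →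
    (∀ x y → f (x R₁.* y) R₂.≈ f x R₂.* f y) → f R₁.1# R₂.≈ R₂.1# →
    (∀ x → f (R₁.- x) R₂.≈ R₂.- f x) →
    IsRingHomomorphism R₁.rawRing R₂.rawRing f
  mkIsRingHomomorphism f f-cong +-homo 0#-homo *-homo 1#-homo -‿homo = record
    { isSemiringHomomorphism = record
      { isNearSemiringHomomorphism = record
        { +-isMonoidHomomorphism = record
          { isMagmaHomomorphism = record { isRelHomomorphism = record { cong = f-cong } ; homo = +-homo }
          ; ε-homo = 0#-homo }
        ; *-homo = *-homo }
      ; 1#-homo = 1#-homo }
    ; -‿homo = -‿homo }

module Polynomials {c ℓ} (R : CommutativeRing c ℓ) where
  open CommutativeRing R hiding (zero)
  open UPoly _+_ _*_ 0# public
  open RingProperties ring using (-0#≈0#)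
  open SetoidReasoning setoid

  Poly : Set c
  Poly = List Carrier

  -- A record rather than a function type, so that p and q can be inferred
  -- from a proof.
  infix 4 _≋_
  record _≋_ (p q : Poly) : Set ℓ where
    constructor mk≋
    field at : ∀ i → coeff p i ≈ coeff q i
  open _≋_ public

  ≋-refl : ∀ {p} → p ≋ p
  ≋-refl = mk≋ λ i → refl

  ≋-sym : ∀ {p q} → p ≋ q → q ≋ p
  ≋-sym e = mk≋ λ i → sym (at e i)

  infixr 2 _⟨≋⟩_
  _⟨≋⟩_ : ∀ {p q r} → p ≋ q → q ≋ r → p ≋ r
  e ⟨≋⟩ f = mk≋ λ i → trans (at e i) (at f i)

  ≋-isEquivalence : IsEquivalence _≋_
  ≋-isEquivalence = record { refl = ≋-refl ; sym = ≋-sym ; trans = _⟨≋⟩_ }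

  C : Carrier → Poly
  C a = a ∷ []

  scale : Carrier → Poly → Poly
  scale x = map (x *_)

  shift : Poly → Poly
  shift p = 0# ∷ p

  negate : Poly → Poly
  negate = map (-_)

  coeff-addP : ∀ p q i → coeff (addP p q) i ≈ coeff p i + coeff q i
  coeff-addP []      q       i       = sym (+-identityˡ _)
  coeff-addP (x ∷ p) []      zero    = sym (+-identityʳ _)
  coeff-addP (x ∷ p) []      (suc i) = sym (+-identityʳ _)
  coeff-addP (x ∷ p) (y ∷ q) zero    = refl
  coeff-addP (x ∷ p) (y ∷ q) (suc i) = coeff-addP p q i

  coeff-scale : ∀ x p i → coeff (scale x p) i ≈ x * coeff p i
  coeff-scale x []      i       = sym (zeroʳ x)
  coeff-scale x (y ∷ p) zero    = refl
  coeff-scale x (y ∷ p) (suc i) = coeff-scale x p i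

  coeff-negate : ∀ p i → coeff (negate p) i ≈ - coeff p i
  coeff-negate []      i       = sym -0#≈0#
  coeff-negate (y ∷ p) zero    = refl
  coeff-negate (y ∷ p) (suc i) = coeff-negate p i

  ∷-cong : ∀ {x y p q} → x ≈ y → p ≋ q → (x ∷ p) ≋ (y ∷ q)
  ∷-cong e f = mk≋ λ { zero → e ; (suc i) → at f i }

  tail-cong : ∀ {x y p q} → (x ∷ p) ≋ (y ∷ q) → p ≋ q
  tail-cong e = mk≋ λ i → at e (suc i)

  ∷≋[]⇒≋[] : ∀ {x p} → (x ∷ p) ≋ [] → p ≋ []
  ∷≋[]⇒≋[] e = mk≋ λ i → at e (suc i)

  shift-cong : ∀ {p q} → p ≋ q → shift p ≋ shift q
  shift-cong = ∷-cong refl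

  shift-[] : shift [] ≋ []
  shift-[] = mk≋ λ { zero → refl ; (suc i) → refl }

  addP-cong : ∀ {p p′ q q′} → p ≋ p′ → q ≋ q′ → addP p q ≋ addP p′ q′
  addP-cong {p} {p′} {q} {q′} e f = mk≋ λ i → begin
    coeff (addP p q) i     ≈⟨ coeff-addP p q i ⟩
    coeff p i + coeff q i   ≈⟨ +-cong (at e i) (at f i) ⟩
    coeff p′ i + coeff q′ i ≈⟨ coeff-addP p′ q′ i ⟨
    coeff (addP p′ q′) i   ∎

  scale-cong : ∀ {x y p q} → x ≈ y → p ≋ q → scale x p ≋ scale y q
  scale-cong {x} {y} {p} {q} e f = mk≋ λ i →
    trans (coeff-scale x p i) (trans (*-cong e (at f i)) (sym (coeff-scale y q i)))

  negate-cong : ∀ {p q} → p ≋ q → negate p ≋ negate q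
  negate-cong {p} {q} f = mk≋ λ i →
    trans (coeff-negate p i) (trans (-‿cong (at f i)) (sym (coeff-negate q i)))

  addP-assoc : ∀ p q r → addP (addP p q) r ≋ addP p (addP q r)
  addP-assoc p q r = mk≋ λ i → begin
    coeff (addP (addP p q) r) i         ≈⟨ trans (coeff-addP (addP p q) r i) (+-congʳ (coeff-addP p q i)) ⟩
    (coeff p i + coeff q i) + coeff r i ≈⟨ +-assoc _ _ _ ⟩
    coeff p i + (coeff q i + coeff r i) ≈⟨ trans (coeff-addP p (addP q r) i) (+-congˡ (coeff-addP q r i)) ⟨
    coeff (addP p (addP q r)) i         ∎

  addP-comm : ∀ p q → addP p q ≋ addP q p
  addP-comm p q = mk≋ λ i → trans (coeff-addP p q i) (trans (+-comm _ _) (sym (coeff-addP q p i)))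

  addP-identityʳ : ∀ p → addP p [] ≋ p
  addP-identityʳ p = mk≋ λ i → trans (coeff-addP p [] i) (+-identityʳ _)

  addP-inverseˡ : ∀ p → addP (negate p) p ≋ []
  addP-inverseˡ p = mk≋ λ i →
    trans (coeff-addP (negate p) p i) (trans (+-congʳ (coeff-negate p i)) (-‿inverseˡ _))

  addP-interchange : ∀ p q r s → addP (addP p q) (addP r s) ≋ addP (addP p r) (addP q s)
  addP-interchange p q r s =
    addP-assoc p q (addP r s) ⟨≋⟩ addP-cong (≋-refl {p}) (≋-sym (addP-assoc q r s)
      ⟨≋⟩ addP-cong (addP-comm q r) ≋-refl ⟨≋⟩ addP-assoc r q s) ⟨≋⟩ ≋-sym (addP-assoc p r (addP q s))

  shift-addP : ∀ p q → shift (addP p q) ≋ addP (shift p) (shift q)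
  shift-addP p q = ∷-cong (sym (+-identityʳ 0#)) ≋-refl

  scale-addPʳ : ∀ x p q → scale x (addP p q) ≋ addP (scale x p) (scale x q)
  scale-addPʳ x p q = mk≋ λ i → begin
    coeff (scale x (addP p q)) i               ≈⟨ trans (coeff-scale x (addP p q) i) (*-congˡ (coeff-addP p q i)) ⟩
    x * (coeff p i + coeff q i)                ≈⟨ distribˡ x _ _ ⟩
    x * coeff p i + x * coeff q i
      ≈⟨ trans (coeff-addP (scale x p) (scale x q) i) (+-cong (coeff-scale x p i) (coeff-scale x q i)) ⟨
    coeff (addP (scale x p) (scale x q)) i     ∎

  scale-+ : ∀ x y p → scale (x + y) p ≋ addP (scale x p) (scale y p)
  scale-+ x y p = mk≋ λ i → begin
    coeff (scale (x + y) p) i              ≈⟨ coeff-scale (x + y) p i ⟩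
    (x + y) * coeff p i                    ≈⟨ distribʳ _ x y ⟩
    x * coeff p i + y * coeff p i
      ≈⟨ trans (coeff-addP (scale x p) (scale y p) i) (+-cong (coeff-scale x p i) (coeff-scale y p i)) ⟨
    coeff (addP (scale x p) (scale y p)) i ∎

  scale-* : ∀ x y p → scale x (scale y p) ≋ scale (x * y) p
  scale-* x y p = mk≋ λ i → begin
    coeff (scale x (scale y p)) i ≈⟨ trans (coeff-scale x (scale y p) i) (*-congˡ (coeff-scale y p i)) ⟩
    x * (y * coeff p i)           ≈⟨ *-assoc _ _ _ ⟨
    x * y * coeff p i             ≈⟨ coeff-scale (x * y) p i ⟨
    coeff (scale (x * y) p) i     ∎

  scale-shift : ∀ x p → scale x (shift p) ≋ shift (scale x p)
  scale-shift x p = ∷-cong (zeroʳ x) ≋-refl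

  scale-zero : ∀ {x} p → x ≈ 0# → scale x p ≋ []
  scale-zero {x} p e = mk≋ λ i → trans (coeff-scale x p i) (trans (*-congʳ e) (zeroˡ _))

  scale-one : ∀ p → scale 1# p ≋ p
  scale-one p = mk≋ λ i → trans (coeff-scale 1# p i) (*-identityˡ _)

  mulP-zeroˡ : ∀ {p} q → p ≋ [] → mulP p q ≋ []
  mulP-zeroˡ {[]}    q e = ≋-refl
  mulP-zeroˡ {x ∷ p} q e =
    addP-cong (scale-zero q (at e zero)) (shift-cong (mulP-zeroˡ {p} q (∷≋[]⇒≋[] e))) ⟨≋⟩ shift-[]

  mulP-congˡ : ∀ {p p′} q → p ≋ p′ → mulP p q ≋ mulP p′ q
  mulP-congˡ {[]}    {p′}     q e = ≋-sym (mulP-zeroˡ q (≋-sym e))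
  mulP-congˡ {x ∷ p} {[]}     q e = mulP-zeroˡ q e
  mulP-congˡ {x ∷ p} {x′ ∷ p′} q e =
    addP-cong (scale-cong (at e zero) ≋-refl) (shift-cong (mulP-congˡ q (tail-cong e)))

  mulP-congʳ : ∀ p {q q′} → q ≋ q′ → mulP p q ≋ mulP p q′
  mulP-congʳ []      e = ≋-refl
  mulP-congʳ (x ∷ p) e = addP-cong (scale-cong refl e) (shift-cong (mulP-congʳ p e))

  mulP-cong : ∀ {p p′ q q′} → p ≋ p′ → q ≋ q′ → mulP p q ≋ mulP p′ q′
  mulP-cong {p′ = p′} {q} e f = mulP-congˡ q e ⟨≋⟩ mulP-congʳ p′ f

  mulP-zeroʳ : ∀ p → mulP p [] ≋ []
  mulP-zeroʳ []      = ≋-refl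
  mulP-zeroʳ (x ∷ p) = shift-cong (mulP-zeroʳ p) ⟨≋⟩ shift-[]

  mulP-distribʳ : ∀ p p′ q → mulP (addP p p′) q ≋ addP (mulP p q) (mulP p′ q)
  mulP-distribʳ []      p′        q = ≋-refl
  mulP-distribʳ (x ∷ p) []        q = ≋-sym (addP-identityʳ _)
  mulP-distribʳ (x ∷ p) (x′ ∷ p′) q =
    addP-cong (scale-+ x x′ q) (shift-cong (mulP-distribʳ p p′ q) ⟨≋⟩ shift-addP (mulP p q) (mulP p′ q))
    ⟨≋⟩ addP-interchange (scale x q) (scale x′ q) (shift (mulP p q)) (shift (mulP p′ q))

  mulP-distribˡ : ∀ p q q′ → mulP p (addP q q′) ≋ addP (mulP p q) (mulP p q′)
  mulP-distribˡ []      q q′ = ≋-refl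
  mulP-distribˡ (x ∷ p) q q′ =
    addP-cong (scale-addPʳ x q q′) (shift-cong (mulP-distribˡ p q q′) ⟨≋⟩ shift-addP (mulP p q) (mulP p q′))
    ⟨≋⟩ addP-interchange (scale x q) (scale x q′) (shift (mulP p q)) (shift (mulP p q′))

  mulP-scaleˡ : ∀ x p q → mulP (scale x p) q ≋ scale x (mulP p q)
  mulP-scaleˡ x []      q = ≋-refl
  mulP-scaleˡ x (y ∷ p) q =
    addP-cong (≋-sym (scale-* x y q)) (shift-cong (mulP-scaleˡ x p q) ⟨≋⟩ ≋-sym (scale-shift x _))
    ⟨≋⟩ ≋-sym (scale-addPʳ x (scale y q) (shift (mulP p q)))

  mulP-shiftˡ : ∀ p q → mulP (shift p) q ≋ shift (mulP p q)
  mulP-shiftˡ p q = addP-cong (scale-zero q refl) ≋-refl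

  -- The recursion of mulP is on its left argument; this is the matching
  -- recursion on the right, from which commutativity follows.
  mulP-∷ʳ : ∀ p y q → mulP p (y ∷ q) ≋ addP (scale y p) (shift (mulP p q))
  mulP-∷ʳ []      y q = ≋-sym shift-[]
  mulP-∷ʳ (x ∷ p) y q = ∷-cong (trans (+-identityʳ _) (trans (*-comm x y) (sym (+-identityʳ _))))
    (addP-cong (≋-refl {scale x q}) (mulP-∷ʳ p y q)
     ⟨≋⟩ ≋-sym (addP-assoc (scale x q) (scale y p) (shift (mulP p q)))
     ⟨≋⟩ addP-cong (addP-comm (scale x q) (scale y p)) ≋-refl
     ⟨≋⟩ addP-assoc (scale y p) (scale x q) (shift (mulP p q)))

  mulP-comm : ∀ p q → mulP p q ≋ mulP q p
  mulP-comm []      q = ≋-sym (mulP-zeroʳ q)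
  mulP-comm (x ∷ p) q = addP-cong ≋-refl (shift-cong (mulP-comm p q)) ⟨≋⟩ ≋-sym (mulP-∷ʳ q x p)

  mulP-assoc : ∀ p q r → mulP (mulP p q) r ≋ mulP p (mulP q r)
  mulP-assoc []      q r = ≋-refl
  mulP-assoc (x ∷ p) q r =
    mulP-distribʳ (scale x q) (shift (mulP p q)) r
    ⟨≋⟩ addP-cong (mulP-scaleˡ x q r) (mulP-shiftˡ (mulP p q) r ⟨≋⟩ shift-cong (mulP-assoc p q r))

  mulP-Cˡ : ∀ a p → mulP (C a) p ≋ scale a p
  mulP-Cˡ a p = addP-cong ≋-refl shift-[] ⟨≋⟩ addP-identityʳ _

  mulP-identityˡ : ∀ p → mulP (C 1#) p ≋ p
  mulP-identityˡ p = mulP-Cˡ 1# p ⟨≋⟩ scale-one p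

  polynomialRing : CommutativeRing c ℓ
  polynomialRing = record
    { Carrier = Poly
    ; _≈_     = _≋_
    ; _+_     = addP
    ; _*_     = mulP
    ; -_      = negate
    ; 0#      = []
    ; 1#      = C 1#
    ; isCommutativeRing = record
      { isRing = record
        { +-isAbelianGroup = record
          { isGroup = record
            { isMonoid = record
              { isSemigroup = record
                { isMagma = record { isEquivalence = ≋-isEquivalence ; ∙-cong = addP-cong }
                ; assoc   = addP-assoc }
              ; identity = (λ p → ≋-refl) , addP-identityʳ }
            ; inverse = addP-inverseˡ , λ p → addP-comm p (negate p) ⟨≋⟩ addP-inverseˡ p
            ; ⁻¹-cong = negate-cong }
          ; comm = addP-comm }
        ; *-cong     = mulP-cong
        ; *-assoc    = mulP-assoc
        ; *-identity = mulP-identityˡ , λ p → mulP-comm p (C 1#) ⟨≋⟩ mulP-identityˡ p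
        ; distrib    = mulP-distribˡ , λ q p p′ → mulP-distribʳ p p′ q }
      ; *-comm = mulP-comm }
    }

  map-cong : ∀ {a} {A : Set a} {f g : A → Carrier} → (∀ x → f x ≈ g x) → ∀ xs → map f xs ≋ map g xs
  map-cong f≈g []       = ≋-refl
  map-cong f≈g (x ∷ xs) = ∷-cong (f≈g x) (map-cong f≈g xs)

  C-isRingHomomorphism : IsRingHomomorphism rawRing (CommutativeRing.rawRing polynomialRing) C
  C-isRingHomomorphism = mkIsRingHomomorphism R polynomialRing C
    (λ e → ∷-cong e ≋-refl) (λ x y → ≋-refl) shift-[] (λ x y → ≋-sym (mulP-Cˡ x (C y))) ≋-refl (λ x → ≋-refl)

  X : Poly
  X = shift (C 1#)

  X*-cancelˡ : ∀ p q → mulP X p ≋ mulP X q → p ≋ q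
  X*-cancelˡ p q e = tail-cong (≋-sym (X*≋shift p) ⟨≋⟩ e ⟨≋⟩ X*≋shift q)
    where
    X*≋shift : ∀ p → mulP X p ≋ shift p
    X*≋shift p = mulP-shiftˡ (C 1#) p ⟨≋⟩ shift-cong (mulP-identityˡ p)

module Folds {c ℓ} (R : CommutativeSemiring c ℓ) where
  open CommutativeSemiring R
  open Exp R public using (_^_; ^-congˡ; ^-assocʳ; ^-distrib-*)
  open SetoidReasoning setoid

  product : List Carrier → Carrier
  product = foldr _*_ 1#

  sum : List Carrier → Carrier
  sum = foldr _+_ 0#

  trace : ℕ → Carrier → Carrier
  trace e x = sum (map (λ i → x ^ (2 ℕ.^ i)) (upTo e))

  product-map-cong : ∀ {a} {A : Set a} {f g : A → Carrier} → (∀ x → f x ≈ g x) →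
    ∀ xs → product (map f xs) ≈ product (map g xs)
  product-map-cong f≈g []       = refl
  product-map-cong f≈g (x ∷ xs) = *-cong (f≈g x) (product-map-cong f≈g xs)

  product-map-cong-local : ∀ {a p} {A : Set a} {P : A → Set p} {f g : A → Carrier} {xs} →
    All P xs → (∀ {x} → P x → f x ≈ g x) → product (map f xs) ≈ product (map g xs)
  product-map-cong-local []         f≈g = refl
  product-map-cong-local (px ∷ pxs) f≈g = *-cong (f≈g px) (product-map-cong-local pxs f≈g)

  product-map-* : ∀ {a} {A : Set a} (f g : A → Carrier) xs →
    product (map (λ x → f x * g x) xs) ≈ product (map f xs) * product (map g xs)
  product-map-* f g []       = sym (*-identityˡ 1#)
  product-map-* f g (x ∷ xs) = trans (*-congˡ (product-map-* f g xs)) (interchange _ _ _ _)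
    where
    interchange : ∀ a b c d → (a * b) * (c * d) ≈ (a * c) * (b * d)
    interchange = solve 4 (λ a b c d → (a :* b) :* (c :* d) := (a :* c) :* (b :* d)) refl
      where open Solver R using (solve; _:=_; _:*_)

  product-map-const : ∀ {a} {A : Set a} y (xs : List A) → product (map (λ _ → y) xs) ≈ y ^ length xs
  product-map-const y []       = refl
  product-map-const y (x ∷ xs) = *-congˡ (product-map-const y xs)

  sum-map-cong : ∀ {a} {A : Set a} {f g : A → Carrier} → (∀ x → f x ≈ g x) →
    ∀ xs → sum (map f xs) ≈ sum (map g xs)
  sum-map-cong f≈g []       = refl
  sum-map-cong f≈g (x ∷ xs) = +-cong (f≈g x) (sum-map-cong f≈g xs)

  telescope : ∀ (f F : ℕ → Carrier) → (∀ i → f i + F i ≈ F (suc i)) →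
    ∀ n → sum (applyUpTo f n) + F 0 ≈ F n
  telescope f F step zero    = +-identityˡ (F 0)
  telescope f F step (suc n) = begin
    (f 0 + sum (applyUpTo (f ∘ suc) n)) + F 0 ≈⟨ +-congʳ (+-comm _ _) ⟩
    (sum (applyUpTo (f ∘ suc) n) + f 0) + F 0 ≈⟨ +-assoc _ _ _ ⟩
    sum (applyUpTo (f ∘ suc) n) + (f 0 + F 0) ≈⟨ +-congˡ (step 0) ⟩
    sum (applyUpTo (f ∘ suc) n) + F 1         ≈⟨ telescope (f ∘ suc) (F ∘ suc) (step ∘ suc) n ⟩
    F (suc n)                                 ∎

  1#^n≈1# : ∀ n → 1# ^ n ≈ 1#
  1#^n≈1# zero    = refl
  1#^n≈1# (suc n) = trans (*-identityˡ _) (1#^n≈1# n)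

  ^-cancelˡ : ∀ {a} → (∀ x y → a * x ≈ a * y → x ≈ y) → ∀ n x y → a ^ n * x ≈ a ^ n * y → x ≈ y
  ^-cancelˡ a-cancel zero    x y e = trans (sym (*-identityˡ x)) (trans e (*-identityˡ y))
  ^-cancelˡ {a} a-cancel (suc n) x y e =
    ^-cancelˡ a-cancel n x y (a-cancel _ _ (trans (sym (*-assoc a _ x)) (trans e (*-assoc a _ y))))

HasCharacteristicTwo : ∀ {c ℓ} → CommutativeRing c ℓ → Set ℓ
HasCharacteristicTwo R = 1# + 1# ≈ 0#
  where open CommutativeRing R

module RingHomomorphism {c₁ ℓ₁ c₂ ℓ₂} {R₁ : CommutativeRing c₁ ℓ₁} {R₂ : CommutativeRing c₂ ℓ₂}
  {f : CommutativeRing.Carrier R₁ → CommutativeRing.Carrier R₂}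
  (f-isRingHomomorphism : IsRingHomomorphism (CommutativeRing.rawRing R₁) (CommutativeRing.rawRing R₂) f)
  where
  private
    module R₁ = CommutativeRing R₁
    module R₂ = CommutativeRing R₂
    module F₁ = Folds R₁.commutativeSemiring
    module F₂ = Folds R₂.commutativeSemiring
  open IsRingHomomorphism f-isRingHomomorphism public
  open R₂ using (trans; +-cong; *-congˡ)

  ^-homo : ∀ x n → f (x F₁.^ n) R₂.≈ f x F₂.^ n
  ^-homo x zero    = 1#-homo
  ^-homo x (suc n) = trans (*-homo _ _) (*-congˡ (^-homo x n))

  product-homo : ∀ {a} {A : Set a} (g : A → R₁.Carrier) xs →
    f (F₁.product (map g xs)) R₂.≈ F₂.product (map (f ∘ g) xs)
  product-homo g []       = 1#-homo
  product-homo g (x ∷ xs) = trans (*-homo _ _) (*-congˡ (product-homo g xs))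

  sum-homo : ∀ {a} {A : Set a} (g : A → R₁.Carrier) xs →
    f (F₁.sum (map g xs)) R₂.≈ F₂.sum (map (f ∘ g) xs)
  sum-homo g []       = 0#-homo
  sum-homo g (x ∷ xs) = trans (+-homo _ _) (+-cong R₂.refl (sum-homo g xs))

  trace-homo : ∀ e x → f (F₁.trace e x) R₂.≈ F₂.trace e (f x)
  trace-homo e x = trans (sum-homo _ (upTo e)) (F₂.sum-map-cong (λ i → ^-homo x (2 ℕ.^ i)) (upTo e))

  characteristic-two : HasCharacteristicTwo R₁ → HasCharacteristicTwo R₂
  characteristic-two two≈0 = R₂.trans (+-cong (R₂.sym 1#-homo) (R₂.sym 1#-homo))
    (trans (R₂.sym (+-homo _ _)) (trans (⟦⟧-cong two≈0) 0#-homo))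

module CharacteristicTwo {c ℓ} (R : CommutativeRing c ℓ) (two≈0 : HasCharacteristicTwo R) where
  open CommutativeRing R
  open Folds commutativeSemiring
  open Solver commutativeSemiring using (solve; _:=_; _:+_; _:*_; con)
  open SetoidReasoning setoid

  x+x≈0 : ∀ x → x + x ≈ 0#
  x+x≈0 x = begin
    x + x             ≈⟨ +-cong (*-identityˡ x) (*-identityˡ x) ⟨
    1# * x + 1# * x   ≈⟨ distribʳ x 1# 1# ⟨
    (1# + 1#) * x     ≈⟨ *-congʳ two≈0 ⟩
    0# * x            ≈⟨ zeroˡ x ⟩
    0#                ∎

  -x≈x : ∀ x → - x ≈ x
  -x≈x x = begin
    - x             ≈⟨ +-identityʳ (- x) ⟨
    - x + 0#        ≈⟨ +-congˡ (x+x≈0 x) ⟨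
    - x + (x + x)   ≈⟨ +-assoc _ _ _ ⟨
    (- x + x) + x   ≈⟨ +-congʳ (-‿inverseˡ x) ⟩
    0# + x          ≈⟨ +-identityˡ x ⟩
    x               ∎

  square-+ : ∀ x y → (x + y) ^ 2 ≈ x ^ 2 + y ^ 2
  square-+ x y = begin
    (x + y) ^ 2                         ≈⟨ expand x y ⟩
    x ^ 2 + y ^ 2 + (x * y + x * y)     ≈⟨ +-congˡ (x+x≈0 (x * y)) ⟩
    x ^ 2 + y ^ 2 + 0#                  ≈⟨ +-identityʳ _ ⟩
    x ^ 2 + y ^ 2                       ∎
    where
    expand : ∀ x y → (x + y) * ((x + y) * 1#) ≈ x * (x * 1#) + y * (y * 1#) + (x * y + x * y)
    expand = solve 2 (λ x y → (x :+ y) :* ((x :+ y) :* con 1)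
                              := x :* (x :* con 1) :+ y :* (y :* con 1) :+ (x :* y :+ x :* y)) refl

  frobenius : ∀ i x y → (x + y) ^ (2 ℕ.^ i) ≈ x ^ (2 ℕ.^ i) + y ^ (2 ℕ.^ i)
  frobenius zero    x y = distribʳ 1# x y
  frobenius (suc i) x y = begin
    (x + y) ^ (2 ℕ.* 2 ℕ.^ i)                   ≈⟨ ^-assocʳ (x + y) 2 (2 ℕ.^ i) ⟨
    ((x + y) ^ 2) ^ (2 ℕ.^ i)                   ≈⟨ ^-congˡ (2 ℕ.^ i) (square-+ x y) ⟩
    (x ^ 2 + y ^ 2) ^ (2 ℕ.^ i)                 ≈⟨ frobenius i (x ^ 2) (y ^ 2) ⟩
    (x ^ 2) ^ (2 ℕ.^ i) + (y ^ 2) ^ (2 ℕ.^ i)   ≈⟨ +-cong (^-assocʳ x 2 (2 ℕ.^ i)) (^-assocʳ y 2 (2 ℕ.^ i)) ⟩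
    x ^ (2 ℕ.* 2 ℕ.^ i) + y ^ (2 ℕ.* 2 ℕ.^ i)   ∎

  module ArtinSchreier (t β : Carrier) (β*β≈β+t : β * β ≈ β + t) where

    conjugates-split : ∀ x → x * x + x + t ≈ (β + x) * ((β + 1#) + x)
    conjugates-split x = begin
      x * x + x + t                                       ≈⟨ +-congˡ t≈β*β+β ⟩
      x * x + x + (β * β + β)                             ≈⟨ +-identityʳ _ ⟨
      x * x + x + (β * β + β) + 0#                        ≈⟨ +-congˡ (x+x≈0 (x * β)) ⟨
      x * x + x + (β * β + β) + (x * β + x * β)           ≈⟨ expand x β ⟩
      (β + x) * ((β + 1#) + x)                            ∎
      where
      t≈β*β+β : t ≈ β * β + β
      t≈β*β+β = begin
        t             ≈⟨ +-identityˡ t ⟨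
        0# + t        ≈⟨ +-congʳ (x+x≈0 β) ⟨
        (β + β) + t   ≈⟨ +-assoc β β t ⟩
        β + (β + t)   ≈⟨ +-comm β _ ⟩
        (β + t) + β   ≈⟨ +-congʳ β*β≈β+t ⟨
        β * β + β     ∎
      expand : ∀ x b → x * x + x + (b * b + b) + (x * b + x * b) ≈ (b + x) * ((b + 1#) + x)
      expand = solve 2 (λ x b → x :* x :+ x :+ (b :* b :+ b) :+ (x :* b :+ x :* b)
                                := (b :+ x) :* ((b :+ con 1) :+ x)) refl

    conjugates-product : β * (β + 1#) ≈ t
    conjugates-product = begin
      β * (β + 1#)     ≈⟨ distribˡ β β 1# ⟩
      β * β + β * 1#   ≈⟨ +-cong β*β≈β+t (*-identityʳ β) ⟩
      (β + t) + β      ≈⟨ +-comm _ β ⟩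
      β + (β + t)      ≈⟨ +-assoc β β t ⟨
      (β + β) + t      ≈⟨ +-congʳ (x+x≈0 β) ⟩
      0# + t           ≈⟨ +-identityˡ t ⟩
      t                ∎

    trace≈β^2^e+β : ∀ e → trace e t + β ≈ β ^ (2 ℕ.^ e)
    trace≈β^2^e+β e = begin
      sum (map (λ i → t ^ (2 ℕ.^ i)) (upTo e)) + β               ≡⟨ ≡.cong (λ s → sum s + β) (List.map-applyUpTo id _ e) ⟩
      sum (applyUpTo (λ i → t ^ (2 ℕ.^ i)) e) + β                ≈⟨ +-congˡ (*-identityʳ β) ⟨
      sum (applyUpTo (λ i → t ^ (2 ℕ.^ i)) e) + β ^ (2 ℕ.^ 0)    ≈⟨ telescope _ (λ i → β ^ (2 ℕ.^ i)) step e ⟩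
      β ^ (2 ℕ.^ e)                                              ∎
      where
      step : ∀ i → t ^ (2 ℕ.^ i) + β ^ (2 ℕ.^ i) ≈ β ^ (2 ℕ.^ suc i)
      step i = begin
        t ^ (2 ℕ.^ i) + β ^ (2 ℕ.^ i)   ≈⟨ +-comm _ _ ⟩
        β ^ (2 ℕ.^ i) + t ^ (2 ℕ.^ i)   ≈⟨ frobenius i β t ⟨
        (β + t) ^ (2 ℕ.^ i)             ≈⟨ ^-congˡ (2 ℕ.^ i) (trans (*-congˡ (*-identityʳ β)) β*β≈β+t) ⟨
        (β ^ 2) ^ (2 ℕ.^ i)             ≈⟨ ^-assocʳ β 2 (2 ℕ.^ i) ⟩
        β ^ (2 ℕ.^ suc i)               ∎

    conjugates-sum : ∀ e → β ^ suc (2 ℕ.^ e) + (β + 1#) ^ suc (2 ℕ.^ e) ≈ trace e t + 1#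
    conjugates-sum e = begin
      β * p + (β + 1#) * (β + 1#) ^ q     ≈⟨ +-congˡ (*-congˡ (trans (frobenius e β 1#) (+-congˡ (1#^n≈1# q)))) ⟩
      β * p + (β + 1#) * (p + 1#)         ≈⟨ expand β p ⟩
      (β * p + β * p) + (p + β) + 1#      ≈⟨ +-congʳ (trans (+-congʳ (x+x≈0 (β * p))) (+-identityˡ _)) ⟩
      (p + β) + 1#                        ≈⟨ +-congʳ (+-congʳ (trace≈β^2^e+β e)) ⟨
      ((trace e t + β) + β) + 1#          ≈⟨ +-congʳ (trans (+-assoc _ β β) (trans (+-congˡ (x+x≈0 β)) (+-identityʳ _))) ⟩
      trace e t + 1#                      ∎
      where
      q : ℕ
      q = 2 ℕ.^ e
      p : Carrier
      p = β ^ q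
      expand : ∀ b p → b * p + (b + 1#) * (p + 1#) ≈ (b * p + b * p) + (p + b) + 1#
      expand = solve 2 (λ b p → b :* p :+ (b :+ con 1) :* (p :+ con 1) := (b :* p :+ b :* p) :+ (p :+ b) :+ con 1) refl


    conjugates-factorisation : ∀ e y → let n = suc (2 ℕ.^ e) in
      (β ^ n + y ^ n) * ((β + 1#) ^ n + y ^ n) ≈ y ^ n * (y ^ n + (trace e t + 1#)) + t ^ n
    conjugates-factorisation e y = begin
      (β ^ n + y ^ n) * ((β + 1#) ^ n + y ^ n)                           ≈⟨ expand (y ^ n) (β ^ n) ((β + 1#) ^ n) ⟩
      y ^ n * y ^ n + y ^ n * (β ^ n + (β + 1#) ^ n) + β ^ n * (β + 1#) ^ n
        ≈⟨ +-cong (+-congˡ (*-congˡ (conjugates-sum e)))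
                  (trans (sym (^-distrib-* β (β + 1#) n)) (^-congˡ n conjugates-product)) ⟩
      y ^ n * y ^ n + y ^ n * (trace e t + 1#) + t ^ n                   ≈⟨ +-congʳ (distribˡ (y ^ n) _ _) ⟨
      y ^ n * (y ^ n + (trace e t + 1#)) + t ^ n                         ∎
      where
      n : ℕ
      n = suc (2 ℕ.^ e)
      expand : ∀ a p r → (p + a) * (r + a) ≈ a * a + a * (p + r) + p * r
      expand = solve 3 (λ a p r → (p :+ a) :* (r :+ a) := a :* a :+ a :* (p :+ r) :+ p :* r) refl

-- R[β] with β² = β + t, as pairs (a , b) standing for a + b β.
module QuadraticExtension {c ℓ} (R : CommutativeRing c ℓ) (t : CommutativeRing.Carrier R) where
  open CommutativeRing R
  open Solver commutativeSemiring using (solve; _:=_; _:+_; _:*_; con)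

  Q : Set c
  Q = Carrier × Carrier

  infix 4 _≈Q_
  record _≈Q_ (x y : Q) : Set ℓ where
    constructor _,≈_
    field
      fst≈ : proj₁ x ≈ proj₁ y
      snd≈ : proj₂ x ≈ proj₂ y
  open _≈Q_ public

  _+Q_ : Q → Q → Q
  (a , b) +Q (c , d) = (a + c , b + d)

  _*Q_ : Q → Q → Q
  (a , b) *Q (c , d) = (a * c + (b * d) * t , (a * d + b * c) + b * d)

  -Q_ : Q → Q
  -Q (a , b) = (- a , - b)

  ≈Q-isEquivalence : IsEquivalence _≈Q_
  ≈Q-isEquivalence = record
    { refl  = refl ,≈ refl
    ; sym   = λ e → sym (fst≈ e) ,≈ sym (snd≈ e)
    ; trans = λ e f → trans (fst≈ e) (fst≈ f) ,≈ trans (snd≈ e) (snd≈ f) }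

  +Q-cong : ∀ {x y u v} → x ≈Q y → u ≈Q v → (x +Q u) ≈Q (y +Q v)
  +Q-cong {_ , _} {_ , _} {_ , _} {_ , _} (e₁ ,≈ e₂) (f₁ ,≈ f₂) = +-cong e₁ f₁ ,≈ +-cong e₂ f₂

  *Q-cong : ∀ {x y u v} → x ≈Q y → u ≈Q v → (x *Q u) ≈Q (y *Q v)
  *Q-cong {_ , _} {_ , _} {_ , _} {_ , _} (e₁ ,≈ e₂) (f₁ ,≈ f₂) =
    +-cong (*-cong e₁ f₁) (*-congʳ (*-cong e₂ f₂))
    ,≈ +-cong (+-cong (*-cong e₁ f₂) (*-cong e₂ f₁)) (*-cong e₂ f₂)

  -Q-cong : ∀ {x y} → x ≈Q y → (-Q x) ≈Q (-Q y)
  -Q-cong {_ , _} {_ , _} (e₁ ,≈ e₂) = -‿cong e₁ ,≈ -‿cong e₂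

  *Q-assoc : ∀ x y z → ((x *Q y) *Q z) ≈Q (x *Q (y *Q z))
  *Q-assoc (a , b) (c , d) (e , f) = fst a b c d e f t ,≈ snd a b c d e f t
    where
    fst : ∀ a b c d e f t → (a * c + (b * d) * t) * e + (((a * d + b * c) + b * d) * f) * t
                          ≈ a * (c * e + (d * f) * t) + (b * ((c * f + d * e) + d * f)) * t
    fst = solve 7 (λ a b c d e f t → (a :* c :+ (b :* d) :* t) :* e :+ (((a :* d :+ b :* c) :+ b :* d) :* f) :* t
                   := a :* (c :* e :+ (d :* f) :* t) :+ (b :* ((c :* f :+ d :* e) :+ d :* f)) :* t) refl
    snd : ∀ a b c d e f t → ((a * c + (b * d) * t) * f + ((a * d + b * c) + b * d) * e) + ((a * d + b * c) + b * d) * f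
                          ≈ (a * ((c * f + d * e) + d * f) + b * (c * e + (d * f) * t)) + b * ((c * f + d * e) + d * f)
    snd = solve 7 (λ a b c d e f t → ((a :* c :+ (b :* d) :* t) :* f :+ ((a :* d :+ b :* c) :+ b :* d) :* e)
                                     :+ ((a :* d :+ b :* c) :+ b :* d) :* f
                   := (a :* ((c :* f :+ d :* e) :+ d :* f) :+ b :* (c :* e :+ (d :* f) :* t)) :+ b :* ((c :* f :+ d :* e) :+ d :* f)) refl

  *Q-comm : ∀ x y → (x *Q y) ≈Q (y *Q x)
  *Q-comm (a , b) (c , d) = fst a b c d t ,≈ snd a b c d
    where
    fst : ∀ a b c d t → a * c + (b * d) * t ≈ c * a + (d * b) * t
    fst = solve 5 (λ a b c d t → a :* c :+ (b :* d) :* t := c :* a :+ (d :* b) :* t) refl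
    snd : ∀ a b c d → (a * d + b * c) + b * d ≈ (c * b + d * a) + d * b
    snd = solve 4 (λ a b c d → (a :* d :+ b :* c) :+ b :* d := (c :* b :+ d :* a) :+ d :* b) refl

  *Q-identityˡ : ∀ x → ((1# , 0#) *Q x) ≈Q x
  *Q-identityˡ (a , b) = fst a b t ,≈ snd a b
    where
    fst : ∀ a b t → 1# * a + (0# * b) * t ≈ a
    fst = solve 3 (λ a b t → con 1 :* a :+ (con 0 :* b) :* t := a) refl
    snd : ∀ a b → (1# * b + 0# * a) + 0# * b ≈ b
    snd = solve 2 (λ a b → (con 1 :* b :+ con 0 :* a) :+ con 0 :* b := b) refl

  *Q-distribˡ : ∀ x y z → (x *Q (y +Q z)) ≈Q ((x *Q y) +Q (x *Q z))
  *Q-distribˡ (a , b) (c , d) (e , f) = fst a b c d e f t ,≈ snd a b c d e f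
    where
    fst : ∀ a b c d e f t → a * (c + e) + (b * (d + f)) * t ≈ (a * c + (b * d) * t) + (a * e + (b * f) * t)
    fst = solve 7 (λ a b c d e f t → a :* (c :+ e) :+ (b :* (d :+ f)) :* t
                   := (a :* c :+ (b :* d) :* t) :+ (a :* e :+ (b :* f) :* t)) refl
    snd : ∀ a b c d e f → (a * (d + f) + b * (c + e)) + b * (d + f) ≈ ((a * d + b * c) + b * d) + ((a * f + b * e) + b * f)
    snd = solve 6 (λ a b c d e f → (a :* (d :+ f) :+ b :* (c :+ e)) :+ b :* (d :+ f)
                   := ((a :* d :+ b :* c) :+ b :* d) :+ ((a :* f :+ b :* e) :+ b :* f)) refl

  extension : CommutativeRing c ℓ
  extension = record
    { Carrier = Q
    ; _≈_     = _≈Q_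
    ; _+_     = _+Q_
    ; _*_     = _*Q_
    ; -_      = -Q_
    ; 0#      = (0# , 0#)
    ; 1#      = (1# , 0#)
    ; isCommutativeRing = record
      { isRing = record
        { +-isAbelianGroup = record
          { isGroup = record
            { isMonoid = record
              { isSemigroup = record
                { isMagma = record { isEquivalence = ≈Q-isEquivalence ; ∙-cong = +Q-cong }
                ; assoc   = λ { (a , b) (c , d) (e , f) → +-assoc a c e ,≈ +-assoc b d f } }
              ; identity = (λ { (a , b) → +-identityˡ a ,≈ +-identityˡ b })
                         , (λ { (a , b) → +-identityʳ a ,≈ +-identityʳ b }) }
            ; inverse = (λ { (a , b) → -‿inverseˡ a ,≈ -‿inverseˡ b })
                      , (λ { (a , b) → -‿inverseʳ a ,≈ -‿inverseʳ b })
            ; ⁻¹-cong = -Q-cong }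
          ; comm = λ { (a , b) (c , d) → +-comm a c ,≈ +-comm b d } }
        ; *-cong     = *Q-cong
        ; *-assoc    = *Q-assoc
        ; *-identity = *Q-identityˡ , λ x → ≈Q-trans (*Q-comm x _) (*Q-identityˡ x)
        ; distrib    = *Q-distribˡ , λ x y z → ≈Q-trans (*Q-comm (y +Q z) x)
                         (≈Q-trans (*Q-distribˡ x y z) (+Q-cong (*Q-comm x y) (*Q-comm x z))) }
      ; *-comm = *Q-comm }
    }
    where open IsEquivalence ≈Q-isEquivalence using () renaming (trans to ≈Q-trans)

  ι : Carrier → Q
  ι a = (a , 0#)

  ι-isRingHomomorphism : IsRingHomomorphism rawRing (CommutativeRing.rawRing extension) ι
  ι-isRingHomomorphism = mkIsRingHomomorphism R extension ι
    (λ e → e ,≈ refl) (λ a b → refl ,≈ sym (+-identityʳ 0#)) (refl ,≈ refl)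
    (λ a b → fst a b t ,≈ snd a b) (refl ,≈ refl) (λ a → refl ,≈ sym -0#≈0#)
    where
    open RingProperties ring using (-0#≈0#)
    fst : ∀ a b t → a * b ≈ a * b + (0# * 0#) * t
    fst = solve 3 (λ a b t → a :* b := a :* b :+ (con 0 :* con 0) :* t) refl
    snd : ∀ a b → 0# ≈ (a * 0# + 0# * b) + 0# * 0#
    snd = solve 2 (λ a b → con 0 := (a :* con 0 :+ con 0 :* b) :+ con 0 :* con 0) refl

  ι-injective : ∀ {a b} → ι a ≈Q ι b → a ≈ b
  ι-injective = fst≈

  β : Q
  β = (0# , 1#)

  β*β≈β+ιt : (β *Q β) ≈Q (β +Q ι t)
  β*β≈β+ιt = fst t ,≈ snd
    where
    fst : ∀ t → 0# * 0# + (1# * 1#) * t ≈ 0# + t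
    fst = solve 1 (λ t → con 0 :* con 0 :+ (con 1 :* con 1) :* t := con 0 :+ t) refl
    snd : (0# * 1# + 1# * 0#) + 1# * 1# ≈ 1# + 0#
    snd = solve 0 ((con 0 :* con 1 :+ con 1 :* con 0) :+ con 1 :* con 1 := con 1 :+ con 0) refl

module Factorisation {c ℓ} (F : Field c ℓ) where
  open Field F hiding (zero)
  open GroupProperties +-group using (x∙y⁻¹≈ε⇒x≈y)
  open Polynomials commutativeRing
  open Folds commutativeSemiring using (_^_)
  open Folds (CommutativeRing.commutativeSemiring polynomialRing) using () renaming (product to productP)
  open Solver commutativeSemiring using (solve; _:=_; _:+_; _:*_; con)
  open SetoidReasoning setoid

  eval : Poly → Carrier → Carrier
  eval []      x = 0#
  eval (c ∷ p) x = c + x * eval p x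

  linear : Carrier → Poly
  linear w = - w ∷ 1# ∷ []

  linearProduct : List Carrier → Poly
  linearProduct ws = productP (map linear ws)

  linear-* : ∀ w p → mulP (linear w) p ≋ addP (scale (- w) p) (shift p)
  linear-* w p = addP-cong ≋-refl (shift-cong (mulP-identityˡ p))

  -x*y+x*y≈0 : ∀ x y → - x * y + x * y ≈ 0#
  -x*y+x*y≈0 x y = trans (sym (distribʳ y (- x) x)) (trans (*-congʳ (-‿inverseˡ x)) (zeroˡ y))

  -- Synthetic division of the polynomial c + X p by X - a.
  remainder : Carrier → Carrier → Poly → Carrier
  remainder a c []       = c
  remainder a c (c′ ∷ p) = c + a * remainder a c′ p

  quotient : Carrier → Carrier → Poly → Poly
  quotient a c []       = []
  quotient a c (c′ ∷ p) = remainder a c′ p ∷ quotient a c′ p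

  division : ∀ a c p → (c ∷ p) ≋ addP (mulP (linear a) (quotient a c p)) (C (remainder a c p))
  division a c []       = ∷-cong (sym (+-identityˡ c)) (≋-sym (addP-identityʳ _ ⟨≋⟩ mulP-zeroʳ (C 1#)))
  division a c (c′ ∷ p) =
    ∷-cong head (tail ⟨≋⟩ ≋-sym (addP-identityʳ _ ⟨≋⟩ addP-cong ≋-refl (mulP-identityˡ (r ∷ q))))
    where
    q : Poly
    q = quotient a c′ p
    r : Carrier
    r = remainder a c′ p
    head : c ≈ (- a * r + 0#) + (c + a * r)
    head = begin
      c                              ≈⟨ +-identityʳ c ⟨
      c + 0#                         ≈⟨ +-congˡ (-x*y+x*y≈0 a r) ⟨
      c + (- a * r + a * r)          ≈⟨ rearrange c (a * r) (- a * r) ⟩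
      (- a * r + 0#) + (c + a * r)   ∎
      where
      rearrange : ∀ c x y → c + (y + x) ≈ (y + 0#) + (c + x)
      rearrange = solve 3 (λ c x y → c :+ (y :+ x) := (y :+ con 0) :+ (c :+ x)) refl
    tail : (c′ ∷ p) ≋ addP (scale (- a) q) (r ∷ q)
    tail = division a c′ p ⟨≋⟩ addP-cong (linear-* a q) ≋-refl
      ⟨≋⟩ addP-assoc (scale (- a) q) (shift q) (C r)
      ⟨≋⟩ addP-cong ≋-refl (∷-cong (+-identityˡ r) (addP-identityʳ q))

  eval-division : ∀ a c p x → eval (c ∷ p) x ≈ (x - a) * eval (quotient a c p) x + remainder a c p
  eval-division a c []       x = begin
    c + x * 0#                 ≈⟨ trans (+-congˡ (zeroʳ x)) (+-identityʳ c) ⟩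
    c                          ≈⟨ trans (+-congʳ (zeroʳ _)) (+-identityˡ c) ⟨
    (x - a) * 0# + c           ∎
  eval-division a c (c′ ∷ p) x = begin
    c + x * eval (c′ ∷ p) x                                  ≈⟨ +-congˡ (*-congˡ (eval-division a c′ p x)) ⟩
    c + x * ((x - a) * eval q x + r)                         ≈⟨ +-identityʳ _ ⟨
    c + x * ((x - a) * eval q x + r) + 0#                    ≈⟨ +-congˡ (-x*y+x*y≈0 a r) ⟨
    c + x * ((x - a) * eval q x + r) + (- a * r + a * r)     ≈⟨ rearrange c x a (- a) (eval q x) r ⟩
    (x - a) * (r + x * eval q x) + (c + a * r)               ∎
    where
    q : Poly
    q = quotient a c′ p
    r : Carrier
    r = remainder a c′ p
    rearrange : ∀ c x a a⁻ e r → c + x * ((x + a⁻) * e + r) + (a⁻ * r + a * r) ≈ (x + a⁻) * (r + x * e) + (c + a * r)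
    rearrange = solve 6 (λ c x a a⁻ e r → c :+ x :* ((x :+ a⁻) :* e :+ r) :+ (a⁻ :* r :+ a :* r)
                                        := (x :+ a⁻) :* (r :+ x :* e) :+ (c :+ a :* r)) refl

  length-quotient : ∀ a c p → length (quotient a c p) ≡ length p
  length-quotient a c []       = ≡.refl
  length-quotient a c (c′ ∷ p) = ≡.cong suc (length-quotient a c′ p)

  leading-quotient : ∀ a c p m → length p ≡ suc m → coeff (quotient a c p) m ≡ coeff p m
  leading-quotient a c (c′ ∷ [])     zero    _ = ≡.refl
  leading-quotient a c (c′ ∷ c″ ∷ p) (suc m) e = leading-quotient a c′ (c″ ∷ p) m (ℕ.suc-injective e)

  x*y≈0⇒y≈0 : ∀ {x y} → ¬ (x ≈ 0#) → x * y ≈ 0# → y ≈ 0#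
  x*y≈0⇒y≈0 {x} {y} x≉0 xy≈0 = begin
    y                 ≈⟨ *-identityˡ y ⟨
    1# * y            ≈⟨ *-congʳ (trans (sym (inverse x x≉0)) (*-comm x (inv x))) ⟩
    (inv x * x) * y   ≈⟨ *-assoc _ _ _ ⟩
    inv x * (x * y)   ≈⟨ *-congˡ xy≈0 ⟩
    inv x * 0#        ≈⟨ zeroʳ _ ⟩
    0#                ∎

  factor-theorem : ∀ ws f → length f ≡ suc (length ws) → coeff f (length ws) ≈ 1# →
    All (λ w → eval f w ≈ 0#) ws → AllPairs (λ x y → ¬ (x ≈ y)) ws → f ≋ linearProduct ws
  factor-theorem []       (c ∷ [])  _   c≈1 _ _ = ∷-cong c≈1 ≋-refl
  factor-theorem (w ∷ ws) (c ∷ p) len lead (fw≈0 ∷ fws≈0) (w∉ws ∷ distinct) =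
    division w c p ⟨≋⟩ addP-cong (mulP-congʳ (linear w) q≋ws) (∷-cong r≈0 ≋-refl ⟨≋⟩ shift-[])
    ⟨≋⟩ addP-identityʳ _
    where
    q : Poly
    q = quotient w c p
    r : Carrier
    r = remainder w c p
    r≈0 : r ≈ 0#
    r≈0 = begin
      r                       ≈⟨ +-identityˡ r ⟨
      0# + r                  ≈⟨ +-congʳ (trans (*-congʳ (-‿inverseʳ w)) (zeroˡ _)) ⟨
      (w - w) * eval q w + r  ≈⟨ eval-division w c p w ⟨
      eval (c ∷ p) w          ≈⟨ fw≈0 ⟩
      0#                      ∎
    q-vanishes : ∀ {x} → ¬ (w ≈ x) → eval (c ∷ p) x ≈ 0# → eval q x ≈ 0#
    q-vanishes {x} w≉x fx≈0 = x*y≈0⇒y≈0 (λ x-w≈0 → w≉x (sym (x∙y⁻¹≈ε⇒x≈y _ _ x-w≈0))) (begin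
      (x - w) * eval q x       ≈⟨ +-identityʳ _ ⟨
      (x - w) * eval q x + 0#  ≈⟨ +-congˡ r≈0 ⟨
      (x - w) * eval q x + r   ≈⟨ eval-division w c p x ⟨
      eval (c ∷ p) x           ≈⟨ fx≈0 ⟩
      0#                       ∎)
    len-p : length p ≡ suc (length ws)
    len-p = ℕ.suc-injective len
    q≋ws : q ≋ linearProduct ws
    q≋ws = factor-theorem ws q (≡.trans (length-quotient w c p) len-p)
      (≡.subst (_≈ 1#) (≡.sym (leading-quotient w c p (length ws) len-p)) lead)
      (All.zipWith (λ (w≉x , fx≈0) → q-vanishes w≉x fx≈0) (w∉ws , fws≈0)) distinct

  monomial : ℕ → Poly
  monomial zero    = C 1#
  monomial (suc m) = shift (monomial m)

  X^[1+_]-1 : ℕ → Poly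
  X^[1+ m ]-1 = - 1# ∷ monomial m

  eval-monomial : ∀ m x → eval (monomial m) x ≈ x ^ m
  eval-monomial zero    x = trans (+-congˡ (zeroʳ x)) (+-identityʳ 1#)
  eval-monomial (suc m) x = trans (+-identityˡ _) (*-congˡ (eval-monomial m x))

  length-monomial : ∀ m → length (monomial m) ≡ suc m
  length-monomial zero    = ≡.refl
  length-monomial (suc m) = ≡.cong suc (length-monomial m)

  leading-monomial : ∀ m → coeff (monomial m) m ≡ 1#
  leading-monomial zero    = ≡.refl
  leading-monomial (suc m) = leading-monomial m

  roots-of-unity-factorisation : ∀ m ws → length ws ≡ suc m → AllPairs (λ x y → ¬ (x ≈ y)) ws →
    All (λ w → w ^ suc m ≈ 1#) ws → X^[1+ m ]-1 ≋ linearProduct ws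
  roots-of-unity-factorisation m ws len distinct roots = factor-theorem ws X^[1+ m ]-1
    (≡.cong suc (≡.trans (length-monomial m) (≡.sym len)))
    (≡.subst (λ k → coeff X^[1+ m ]-1 k ≈ 1#) (≡.sym len) (reflexive (leading-monomial m)))
    (All.map (λ w^n≈1 → trans (+-congˡ (trans (*-congˡ (eval-monomial m _)) w^n≈1)) (-‿inverseˡ 1#)) roots)
    distinct

  linearProduct-degree : ∀ ws i → length ws < i → coeff (linearProduct ws) i ≈ 0#
  linearProduct-degree []       (suc i) _ = refl
  linearProduct-degree (w ∷ ws) (suc i) (ℕ.s≤s n<i) = begin
    coeff (linearProduct (w ∷ ws)) (suc i)                  ≈⟨ at (linear-* w P) (suc i) ⟩
    coeff (addP (scale (- w) P) (shift P)) (suc i)          ≈⟨ coeff-addP (scale (- w) P) (shift P) (suc i) ⟩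
    coeff (scale (- w) P) (suc i) + coeff P i               ≈⟨ +-cong (coeff-scale (- w) P (suc i)) (linearProduct-degree ws i n<i) ⟩
    - w * coeff P (suc i) + 0#
      ≈⟨ +-congʳ (*-congˡ (linearProduct-degree ws (suc i) (ℕ.m≤n⇒m≤1+n n<i))) ⟩
    - w * 0# + 0#                                           ≈⟨ trans (+-identityʳ _) (zeroʳ _) ⟩
    0#                                                      ∎
    where P = linearProduct ws

module Homogenisation {c ℓ c′ ℓ′} (F : Field c ℓ) {B : CommutativeRing c′ ℓ′}
  {φ : Field.Carrier F → CommutativeRing.Carrier B}
  (φ-isRingHomomorphism : IsRingHomomorphism (Field.rawRing F) (CommutativeRing.rawRing B) φ)
  (a b : CommutativeRing.Carrier B) where
  private
    module K = Field F
    module φ = IsRingHomomorphism φ-isRingHomomorphism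
  open Polynomials K.commutativeRing
  open Factorisation F
  open CommutativeRing B hiding (zero)
  open Folds commutativeSemiring using (_^_; product; product-map-cong)
  open Solver commutativeSemiring using (solve; _:=_; _:+_; _:*_)
  open SetoidReasoning setoid

  -- The degree-d homogenisation of p evaluated at (a , b):
  -- the sum of φ(p_i) a^i b^(d - i) over i ≤ d.
  homogenise : ℕ → Poly → Carrier
  homogenise zero    p = φ (coeff p 0)
  homogenise (suc d) p = φ (coeff p 0) * b ^ suc d + a * homogenise d (drop 1 p)

  coeff-drop1 : ∀ p i → coeff (drop 1 p) i ≡ coeff p (suc i)
  coeff-drop1 []      i = ≡.refl
  coeff-drop1 (x ∷ p) i = ≡.refl

  drop1-cong : ∀ {p q} → p ≋ q → drop 1 p ≋ drop 1 q
  drop1-cong {p} {q} e = mk≋ λ i →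
    ≡.subst₂ K._≈_ (≡.sym (coeff-drop1 p i)) (≡.sym (coeff-drop1 q i)) (at e (suc i))

  homogenise-cong : ∀ d {p q} → p ≋ q → homogenise d p ≈ homogenise d q
  homogenise-cong zero    e = φ.⟦⟧-cong (at e 0)
  homogenise-cong (suc d) e =
    +-cong (*-congʳ (φ.⟦⟧-cong (at e 0))) (*-congˡ (homogenise-cong d (drop1-cong e)))

  homogenise-addP : ∀ d p q → homogenise d (addP p q) ≈ homogenise d p + homogenise d q
  homogenise-addP zero    p q = trans (φ.⟦⟧-cong (coeff-addP p q 0)) (φ.+-homo _ _)
  homogenise-addP (suc d) p q = begin
    φ (coeff (addP p q) 0) * b ^ suc d + a * homogenise d (drop 1 (addP p q))
      ≈⟨ +-cong (*-congʳ (trans (φ.⟦⟧-cong (coeff-addP p q 0)) (φ.+-homo _ _)))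
                (*-congˡ (trans (homogenise-cong d (drop1-addP p q)) (homogenise-addP d (drop 1 p) (drop 1 q)))) ⟩
    (φ (coeff p 0) + φ (coeff q 0)) * b ^ suc d + a * (homogenise d (drop 1 p) + homogenise d (drop 1 q))
      ≈⟨ rearrange _ _ _ _ _ _ ⟩
    homogenise (suc d) p + homogenise (suc d) q ∎
    where
    drop1-addP : ∀ p q → drop 1 (addP p q) ≋ addP (drop 1 p) (drop 1 q)
    drop1-addP []      q       = ≋-refl
    drop1-addP (x ∷ p) []      = ≋-sym (addP-identityʳ p)
    drop1-addP (x ∷ p) (y ∷ q) = ≋-refl
    rearrange : ∀ x y z a u v → (x + y) * z + a * (u + v) ≈ (x * z + a * u) + (y * z + a * v)
    rearrange = solve 6 (λ x y z a u v → (x :+ y) :* z :+ a :* (u :+ v) := (x :* z :+ a :* u) :+ (y :* z :+ a :* v)) refl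

  homogenise-scale : ∀ d x p → homogenise d (scale x p) ≈ φ x * homogenise d p
  homogenise-scale zero    x p = trans (φ.⟦⟧-cong (coeff-scale x p 0)) (φ.*-homo _ _)
  homogenise-scale (suc d) x p = begin
    φ (coeff (scale x p) 0) * b ^ suc d + a * homogenise d (drop 1 (scale x p))
      ≈⟨ +-cong (*-congʳ (trans (φ.⟦⟧-cong (coeff-scale x p 0)) (φ.*-homo _ _)))
                (*-congˡ (≡.subst (λ r → homogenise d r ≈ φ x * homogenise d (drop 1 p))
                            (≡.sym (drop1-scale p)) (homogenise-scale d x (drop 1 p)))) ⟩
    (φ x * φ (coeff p 0)) * b ^ suc d + a * (φ x * homogenise d (drop 1 p))
      ≈⟨ rearrange _ _ _ _ _ ⟩
    φ x * homogenise (suc d) p ∎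
    where
    drop1-scale : ∀ p → drop 1 (scale x p) ≡ scale x (drop 1 p)
    drop1-scale []      = ≡.refl
    drop1-scale (y ∷ p) = ≡.refl
    rearrange : ∀ x y z a u → (x * y) * z + a * (x * u) ≈ x * (y * z + a * u)
    rearrange = solve 5 (λ x y z a u → (x :* y) :* z :+ a :* (x :* u) := x :* (y :* z :+ a :* u)) refl

  homogenise-shift : ∀ d p → homogenise (suc d) (shift p) ≈ a * homogenise d p
  homogenise-shift d p = trans (+-congʳ (trans (*-congʳ φ.0#-homo) (zeroˡ _))) (+-identityˡ _)

  homogenise-suc : ∀ d p → coeff p (suc d) K.≈ K.0# → homogenise (suc d) p ≈ b * homogenise d p
  homogenise-suc zero    p p₁≈0 = begin
    φ (coeff p 0) * (b * 1#) + a * φ (coeff (drop 1 p) 0)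
      ≈⟨ +-cong (*-congˡ (*-identityʳ b)) (*-congˡ (trans (φ.⟦⟧-cong p′₀≈0) φ.0#-homo)) ⟩
    φ (coeff p 0) * b + a * 0#
      ≈⟨ trans (+-congˡ (zeroʳ a)) (trans (+-identityʳ _) (*-comm _ _)) ⟩
    b * φ (coeff p 0) ∎
    where
    p′₀≈0 : coeff (drop 1 p) 0 K.≈ K.0#
    p′₀≈0 = ≡.subst (K._≈ K.0#) (≡.sym (coeff-drop1 p 0)) p₁≈0
  homogenise-suc (suc d) p pₙ≈0 = begin
    φ (coeff p 0) * (b * b ^ suc d) + a * homogenise (suc d) (drop 1 p)
      ≈⟨ +-congˡ (*-congˡ (homogenise-suc d (drop 1 p) (≡.subst (K._≈ K.0#) (≡.sym (coeff-drop1 p (suc d))) pₙ≈0))) ⟩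
    φ (coeff p 0) * (b * b ^ suc d) + a * (b * homogenise d (drop 1 p))
      ≈⟨ rearrange _ _ _ _ _ ⟩
    b * homogenise (suc d) p ∎
    where
    rearrange : ∀ x b z a u → x * (b * z) + a * (b * u) ≈ b * (x * z + a * u)
    rearrange = solve 5 (λ x b z a u → x :* (b :* z) :+ a :* (b :* u) := b :* (x :* z :+ a :* u)) refl

  homogenise-linear : ∀ w d p → coeff p (suc d) K.≈ K.0# →
    homogenise (suc d) (mulP (linear w) p) ≈ (a - φ w * b) * homogenise d p
  homogenise-linear w d p pₙ≈0 = begin
    homogenise (suc d) (mulP (linear w) p)                   ≈⟨ homogenise-cong (suc d) (linear-* w p) ⟩
    homogenise (suc d) (addP (scale (K.- w) p) (shift p))    ≈⟨ homogenise-addP (suc d) (scale (K.- w) p) (shift p) ⟩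
    homogenise (suc d) (scale (K.- w) p) + homogenise (suc d) (shift p)
      ≈⟨ +-cong (homogenise-scale (suc d) (K.- w) p) (homogenise-shift d p) ⟩
    φ (K.- w) * homogenise (suc d) p + a * h                 ≈⟨ +-congʳ (*-cong (φ.-‿homo w) (homogenise-suc d p pₙ≈0)) ⟩
    - φ w * (b * h) + a * h                                  ≈⟨ rearrange (- φ w) b h a ⟩
    (a + - φ w * b) * h                                      ≈⟨ *-congʳ (+-congˡ (-‿distribˡ-* (φ w) b)) ⟨
    (a - φ w * b) * h                                        ∎
    where
    open RingProperties ring using (-‿distribˡ-*)
    h : Carrier
    h = homogenise d p
    rearrange : ∀ x b h a → x * (b * h) + a * h ≈ (a + x * b) * h
    rearrange = solve 4 (λ x b h a → x :* (b :* h) :+ a :* h := (a :+ x :* b) :* h) refl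

  homogenise-linearProduct : ∀ ws →
    homogenise (length ws) (linearProduct ws) ≈ product (map (λ w → a - φ w * b) ws)
  homogenise-linearProduct []       = φ.1#-homo
  homogenise-linearProduct (w ∷ ws) =
    trans (homogenise-linear w (length ws) (linearProduct ws) (linearProduct-degree ws _ (ℕ.n<1+n (length ws))))
          (*-congˡ (homogenise-linearProduct ws))

  homogenise-monomial : ∀ m → homogenise m (monomial m) ≈ a ^ m
  homogenise-monomial zero    = φ.1#-homo
  homogenise-monomial (suc m) = trans (homogenise-shift m (monomial m)) (*-congˡ (homogenise-monomial m))

  homogenise-X^[1+m]-1 : ∀ m → homogenise (suc m) X^[1+ m ]-1 ≈ a ^ suc m - b ^ suc m
  homogenise-X^[1+m]-1 m = begin
    φ (K.- K.1#) * b ^ suc m + a * homogenise m (monomial m)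
      ≈⟨ +-cong (*-congʳ (trans (φ.-‿homo K.1#) (-‿cong φ.1#-homo))) (*-congˡ (homogenise-monomial m)) ⟩
    - 1# * b ^ suc m + a ^ suc m                               ≈⟨ +-congʳ (-1*x≈-x _) ⟩
    - b ^ suc m + a ^ suc m                                    ≈⟨ +-comm _ _ ⟩
    a ^ suc m - b ^ suc m                                      ∎
    where open RingProperties ring using (-1*x≈-x)

  product-roots-of-unity : ∀ m ws → length ws ≡ suc m → AllPairs (λ x y → ¬ (x K.≈ y)) ws →
    All (λ w → (Folds._^_ K.commutativeSemiring w (suc m)) K.≈ K.1#) ws →
    product (map (λ w → a - φ w * b) ws) ≈ a ^ suc m - b ^ suc m
  product-roots-of-unity m ws len distinct roots = begin
    product (map (λ w → a - φ w * b) ws)      ≈⟨ homogenise-linearProduct ws ⟨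
    homogenise (length ws) (linearProduct ws) ≡⟨ ≡.cong (λ k → homogenise k (linearProduct ws)) len ⟩
    homogenise (suc m) (linearProduct ws)     ≈⟨ homogenise-cong (suc m) (roots-of-unity-factorisation m ws len distinct roots) ⟨
    homogenise (suc m) X^[1+ m ]-1            ≈⟨ homogenise-X^[1+m]-1 m ⟩
    a ^ suc m - b ^ suc m                     ∎

  product-roots-of-unity-char2 : HasCharacteristicTwo B → ∀ m ws → length ws ≡ suc m → AllPairs (λ x y → ¬ (x K.≈ y)) ws →
    All (λ w → (Folds._^_ K.commutativeSemiring w (suc m)) K.≈ K.1#) ws →
    product (map (λ w → a + φ w * b) ws) ≈ a ^ suc m + b ^ suc m
  product-roots-of-unity-char2 two≈0 m ws len distinct roots = begin
    product (map (λ w → a + φ w * b) ws)   ≈⟨ product-map-cong (λ w → +-congˡ (sym (-x≈x (φ w * b)))) ws ⟩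
    product (map (λ w → a - φ w * b) ws)   ≈⟨ product-roots-of-unity m ws len distinct roots ⟩
    a ^ suc m - b ^ suc m                  ≈⟨ +-congˡ (-x≈x _) ⟩
    a ^ suc m + b ^ suc m                  ∎
    where open CharacteristicTwo B two≈0 using (-x≈x)

module UnitCircleProduct {c ℓ} (F : Field c ℓ) (two≈0 : HasCharacteristicTwo (Field.commutativeRing F)) where
  private
    module K  = Field F
    module KF = Folds K.commutativeSemiring
    module KP = RingPow K.commutativeRing
    module PK = Polynomials K.commutativeRing
    module PS = Polynomials PK.polynomialRing
  open BiPoly K.commutativeRing

  S : CommutativeRing c ℓ
  S = PS.polynomialRing

  private
    module S  = CommutativeRing S
    module SF = Folds S.commutativeSemiring

  pow≡^ : ∀ x n → KP.pow x n ≡ x KF.^ n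
  pow≡^ x zero    = ≡.refl
  pow≡^ x (suc n) = ≡.cong (x K.*_) (pow≡^ x n)

  ^P≡^ : ∀ P n → P ^P n ≡ P SF.^ n
  ^P≡^ P zero    = ≡.refl
  ^P≡^ P (suc n) = ≡.cong (P *P_) (^P≡^ P n)

  T≡trace : ∀ e P → Trace.T K.commutativeRing e P ≡ SF.trace e P
  T≡trace e P = ≡.cong sumP (List.map-cong (λ i → ^P≡^ P (2 ℕ.^ i)) (upTo e))

  ≈⇒≈P : ∀ {P Q} → P S.≈ Q → P ≈P Q
  ≈⇒≈P P≈Q i j = PK.at (PS.at P≈Q i) j

  const-isRingHomomorphism : IsRingHomomorphism K.rawRing S.rawRing const
  const-isRingHomomorphism =
    Composition.isRingHomomorphism S.trans PK.C-isRingHomomorphism PS.C-isRingHomomorphism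

  private
    module const = IsRingHomomorphism const-isRingHomomorphism

  ·≈const* : ∀ a P → (a · P) S.≈ const a S.* P
  ·≈const* a P = PS.map-cong (λ x → PK.≋-sym (PK.mulP-Cˡ a x)) P PS.⟨≋⟩ PS.≋-sym (PS.mulP-Cˡ (PK.C a) P)

  Y^n*-cancelˡ : ∀ n P Q → Y SF.^ n S.* P S.≈ Y SF.^ n S.* Q → P S.≈ Q
  Y^n*-cancelˡ = SF.^-cancelˡ PS.X*-cancelˡ

  two≈0ˢ : HasCharacteristicTwo S
  two≈0ˢ = RingHomomorphism.characteristic-two {R₁ = K.commutativeRing} {R₂ = S} const-isRingHomomorphism two≈0

  factor : K.Carrier → Poly2
  factor ω = (ω · Y) +P 1P +P (K.inv ω · Z)

  ωY : K.Carrier → Poly2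
  ωY ω = const ω S.* Y

  quadratic : K.Carrier → Poly2
  quadratic ω = ωY ω S.* ωY ω S.+ ωY ω S.+ Y S.* Z

  Y*factor*ω≈quadratic : ∀ {ω} → ¬ (ω K.≈ K.0#) → Y S.* (factor ω S.* const ω) S.≈ quadratic ω
  Y*factor*ω≈quadratic {ω} ω≉0 = begin
    Y * (factor ω * const ω)
      ≈⟨ *-cong (refl {Y}) (*-cong (+-cong (+-cong (·≈const* ω Y) (refl {1#})) (·≈const* (K.inv ω) Z)) (refl {const ω})) ⟩
    Y * ((const ω * Y + 1# + const (K.inv ω) * Z) * const ω)
      ≈⟨ expand (const ω) (const (K.inv ω)) Y Z ⟩
    ωY ω * ωY ω + ωY ω + (const ω * const (K.inv ω)) * (Y * Z)
      ≈⟨ +-cong (refl {ωY ω * ωY ω + ωY ω}) (*-cong ω*ω⁻¹≈1 (refl {Y * Z})) ⟩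
    ωY ω * ωY ω + ωY ω + 1# * (Y * Z)
      ≈⟨ +-cong (refl {ωY ω * ωY ω + ωY ω}) (*-identityˡ (Y * Z)) ⟩
    quadratic ω ∎
    where
    open S
    open SetoidReasoning setoid
    open Solver commutativeSemiring using (solve; _:=_; _:+_; _:*_; con)
    ω*ω⁻¹≈1 : const ω * const (K.inv ω) ≈ 1#
    ω*ω⁻¹≈1 = trans (sym (const.*-homo ω (K.inv ω))) (const.⟦⟧-cong (K.inverse ω ω≉0))
    expand : ∀ a b y z → y * ((a * y + 1# + b * z) * a) ≈ (a * y) * (a * y) + a * y + (a * b) * (y * z)
    expand = solve 4 (λ a b y z → y :* ((a :* y :+ con 1 :+ b :* z) :* a)
                                  := (a :* y) :* (a :* y) :+ a :* y :+ (a :* b) :* (y :* z)) refl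

  private
    module QE = QuadraticExtension S (Y S.* Z)

  A : CommutativeRing c ℓ
  A = QE.extension

  private
    module A  = CommutativeRing A
    module AF = Folds A.commutativeSemiring
    module ι  = RingHomomorphism {R₁ = S} {R₂ = A} QE.ι-isRingHomomorphism

  ι : S.Carrier → A.Carrier
  ι = QE.ι

  β : A.Carrier
  β = QE.β

  ψ : K.Carrier → A.Carrier
  ψ = ι ∘ const

  ψ-isRingHomomorphism : IsRingHomomorphism K.rawRing A.rawRing ψ
  ψ-isRingHomomorphism = Composition.isRingHomomorphism A.trans const-isRingHomomorphism QE.ι-isRingHomomorphism

  two≈0ᴬ : HasCharacteristicTwo A
  two≈0ᴬ = ι.characteristic-two two≈0ˢ

  private
    module AS = CharacteristicTwo.ArtinSchreier A two≈0ᴬ (ι (Y S.* Z)) β QE.β*β≈β+ιt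

  ι-quadratic : ∀ ω → ι (quadratic ω) A.≈ (β A.+ ψ ω A.* ι Y) A.* ((β A.+ A.1#) A.+ ψ ω A.* ι Y)
  ι-quadratic ω = begin
    ι (quadratic ω)              ≈⟨ ι-sum ⟩
    x′ * x′ + x′ + ι (Y S.* Z)   ≈⟨ +-cong (+-cong (*-cong ιωY ιωY) ιωY) (refl {ι (Y S.* Z)}) ⟩
    x * x + x + ι (Y S.* Z)      ≈⟨ AS.conjugates-split x ⟩
    (β + x) * ((β + 1#) + x)     ∎
    where
    open A
    open SetoidReasoning setoid
    x′ x : Carrier
    x′ = ι (ωY ω)
    x  = ψ ω * ι Y
    ιωY : x′ ≈ x
    ιωY = ι.*-homo (const ω) Y
    ι-sum : ι (quadratic ω) ≈ x′ * x′ + x′ + ι (Y S.* Z)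
    ι-sum = trans (ι.+-homo (ωY ω S.* ωY ω S.+ ωY ω) (Y S.* Z))
      (+-cong (trans (ι.+-homo (ωY ω S.* ωY ω) (ωY ω)) (+-cong (ι.*-homo (ωY ω) (ωY ω)) (refl {x′})))
              (refl {ι (Y S.* Z)}))

  rhs : ℕ → Poly2
  rhs e = Y SF.^ suc (2 ℕ.^ e) S.+ Z SF.^ suc (2 ℕ.^ e) S.+ SF.trace e (Y S.* Z) S.+ S.1#

  ι-Y^n*rhs : ∀ e → let n = suc (2 ℕ.^ e) in ι (Y SF.^ n S.* rhs e) A.≈
    ι Y AF.^ n A.* (ι Y AF.^ n A.+ (AF.trace e (ι (Y S.* Z)) A.+ A.1#)) A.+ ι (Y S.* Z) AF.^ n
  ι-Y^n*rhs e = begin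
    ι (Y SF.^ n S.* rhs e)                       ≈⟨ trans (ι.*-homo (Y SF.^ n) (rhs e)) (*-cong (ι.^-homo Y n) ι-rhs) ⟩
    y ^ n * (y ^ n + z ^ n + T + 1#)             ≈⟨ rearrange (y ^ n) (z ^ n) T ⟩
    y ^ n * (y ^ n + (T + 1#)) + y ^ n * z ^ n   ≈⟨ +-cong (refl {y ^ n * (y ^ n + (T + 1#))}) ιyz^n ⟨
    y ^ n * (y ^ n + (T + 1#)) + ι (Y S.* Z) ^ n ∎
    where
    open A
    open AF
    open SetoidReasoning setoid
    open Solver commutativeSemiring using (solve; _:=_; _:+_; _:*_; con)
    n : ℕ
    n = suc (2 ℕ.^ e)
    y z T : Carrier
    y = ι Y
    z = ι Z
    T = trace e (ι (Y S.* Z))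
    ι-rhs : ι (rhs e) ≈ y ^ n + z ^ n + T + 1#
    ι-rhs = trans (ι.+-homo (Y SF.^ n S.+ Z SF.^ n S.+ SF.trace e (Y S.* Z)) S.1#)
      (+-cong (trans (ι.+-homo (Y SF.^ n S.+ Z SF.^ n) (SF.trace e (Y S.* Z)))
                (+-cong (trans (ι.+-homo (Y SF.^ n) (Z SF.^ n)) (+-cong (ι.^-homo Y n) (ι.^-homo Z n)))
                        (ι.trace-homo e (Y S.* Z))))
              ι.1#-homo)
    ιyz^n : ι (Y S.* Z) ^ n ≈ y ^ n * z ^ n
    ιyz^n = trans (^-congˡ n (ι.*-homo Y Z)) (^-distrib-* y z n)
    rearrange : ∀ a b t → a * (a + b + t + 1#) ≈ a * (a + (t + 1#)) + a * b
    rearrange = solve 3 (λ a b t → a :* (a :+ b :+ t :+ con 1) := a :* (a :+ (t :+ con 1)) :+ a :* b) refl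

  module _ (e : ℕ) (ws : List K.Carrier) (len : length ws ≡ suc (2 ℕ.^ e))
    (distinct : AllPairs (λ x y → ¬ (x K.≈ y)) ws)
    (roots : All (λ ω → ω KF.^ suc (2 ℕ.^ e) K.≈ K.1#) ws) where

    n : ℕ
    n = suc (2 ℕ.^ e)

    roots≉0 : All (λ ω → ¬ (ω K.≈ K.0#)) ws
    roots≉0 = All.map (λ ωⁿ≈1 ω≈0 → K.0≉1 (K.trans (K.sym (K.trans (K.*-congʳ ω≈0) (K.zeroˡ _))) ωⁿ≈1)) roots

    product-const≈1 : SF.product (map const ws) S.≈ S.1#
    product-const≈1 = begin
      product (map const ws)                       ≈⟨ product-map-cong (λ ω → sym (0+x*1≈x (const ω))) ws ⟩
      product (map (λ ω → 0# + const ω * 1#) ws)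
        ≈⟨ Homogenisation.product-roots-of-unity-char2 F {B = S} const-isRingHomomorphism 0# 1# two≈0ˢ
             (2 ℕ.^ e) ws len distinct roots ⟩
      0# ^ n + 1# ^ n                              ≈⟨ +-cong (zeroˡ (0# ^ 2 ℕ.^ e)) (1#^n≈1# n) ⟩
      0# + 1#                                      ≈⟨ +-identityˡ 1# ⟩
      1#                                           ∎
      where
      open S
      open SF
      open SetoidReasoning setoid
      0+x*1≈x : ∀ x → 0# + x * 1# ≈ x
      0+x*1≈x x = trans (+-identityˡ (x * 1#)) (*-identityʳ x)

    Y^n*product≈product-quadratic : Y SF.^ n S.* prodP (map factor ws) S.≈ SF.product (map quadratic ws)
    Y^n*product≈product-quadratic = begin
      Y ^ n * P                                                   ≈⟨ *-cong (refl {Y ^ n}) (*-identityʳ P) ⟨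
      Y ^ n * (P * 1#)                                            ≈⟨ *-cong (refl {Y ^ n}) (*-cong (refl {P}) product-const≈1) ⟨
      Y ^ n * (P * product (map const ws))                        ≈⟨ *-cong Y^n≈∏Y (refl {P * product (map const ws)}) ⟩
      product (map (λ _ → Y) ws) * (P * product (map const ws))
        ≈⟨ *-cong (refl {product (map (λ _ → Y) ws)}) (product-map-* factor const ws) ⟨
      product (map (λ _ → Y) ws) * product (map (λ ω → factor ω * const ω) ws)
        ≈⟨ product-map-* (λ _ → Y) (λ ω → factor ω * const ω) ws ⟨
      product (map (λ ω → Y * (factor ω * const ω)) ws)           ≈⟨ product-map-cong-local roots≉0 Y*factor*ω≈quadratic ⟩
      product (map quadratic ws)                                  ∎
      where
      open S
      open SF
      open SetoidReasoning setoid
      P : Poly2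
      P = prodP (map factor ws)
      Y^n≈∏Y : Y ^ n ≈ product (map (λ _ → Y) ws)
      Y^n≈∏Y = sym (trans (product-map-const Y ws) (reflexive (≡.cong (Y ^_) len)))

    ι-product-quadratic : ι (SF.product (map quadratic ws)) A.≈
      ι Y AF.^ n A.* (ι Y AF.^ n A.+ (AF.trace e (ι (Y S.* Z)) A.+ A.1#)) A.+ ι (Y S.* Z) AF.^ n
    ι-product-quadratic = begin
      ι (SF.product (map quadratic ws))                               ≈⟨ ι.product-homo quadratic ws ⟩
      product (map (ι ∘ quadratic) ws)                                ≈⟨ product-map-cong ι-quadratic ws ⟩
      product (map (λ ω → (β + ψ ω * y) * ((β + 1#) + ψ ω * y)) ws)
        ≈⟨ product-map-* (λ ω → β + ψ ω * y) (λ ω → (β + 1#) + ψ ω * y) ws ⟩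
      product (map (λ ω → β + ψ ω * y) ws) * product (map (λ ω → (β + 1#) + ψ ω * y) ws)
        ≈⟨ *-cong (roots-product β) (roots-product (β + 1#)) ⟩
      (β ^ n + y ^ n) * ((β + 1#) ^ n + y ^ n)                        ≈⟨ AS.conjugates-factorisation e y ⟩
      y ^ n * (y ^ n + (trace e (ι (Y S.* Z)) + 1#)) + ι (Y S.* Z) ^ n ∎
      where
      open A
      open AF
      open SetoidReasoning setoid
      y : Carrier
      y = ι Y
      roots-product : ∀ a → product (map (λ ω → a + ψ ω * y) ws) ≈ a ^ n + y ^ n
      roots-product a = Homogenisation.product-roots-of-unity-char2 F {B = A} ψ-isRingHomomorphism a y
        two≈0ᴬ (2 ℕ.^ e) ws len distinct roots

    product-formula : prodP (map factor ws) S.≈ rhs e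
    product-formula = Y^n*-cancelˡ n (prodP (map factor ws)) (rhs e) (QE.ι-injective
      (A.trans (ι.⟦⟧-cong Y^n*product≈product-quadratic) (A.trans ι-product-quadratic (A.sym (ι-Y^n*rhs e)))))

open import Data.Nat using (_^_)

lemma10p3 : ∀ {c ℓ} (F : Field c ℓ) → 
  let open Field F
      open BiPoly commutativeRing
      open RingPow commutativeRing
      open Trace commutativeRing
  in
  (1# + 1#) ≈ 0# →
  (e : ℕ) → 1 < e →
  (ws : List Carrier) → length ws ≡ 2 ^ e ℕ.+ 1 →
  AllPairs (λ x y → ¬ (x ≈ y)) ws →
  All (λ ω → pow ω (2 ^ e ℕ.+ 1) ≈ 1#) ws →
  prodP (map (λ ω → (ω · Y) +P 1P +P (inv ω · Z)) ws)
    ≈P (Y ^P (2 ^ e ℕ.+ 1)) +P (Z ^P (2 ^ e ℕ.+ 1)) +P T e (Y *P Z) +P 1P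
lemma10p3 F two≈0 e _ ws len distinct roots rewrite ℕ.+-comm (2 ^ e) 1 =
  ≈⇒≈P (≡.subst (prodP (map factor ws) S.≈_) (≡.sym rhs≡)
    (product-formula e ws len distinct (All.map (λ {ω} → ≡.subst (_≈ 1#) (pow≡^ ω (suc (2 ^ e)))) roots)))
  where
  open Field F
  open BiPoly commutativeRing
  open UnitCircleProduct F two≈0
  module S = CommutativeRing S
  rhs≡ : (Y ^P suc (2 ^ e)) +P (Z ^P suc (2 ^ e)) +P Trace.T commutativeRing e (Y *P Z) +P 1P ≡ rhs e
  rhs≡ = ≡.cong₂ (λ P Q → P +P Q +P 1P)
    (≡.cong₂ _+P_ (^P≡^ Y (suc (2 ^ e))) (^P≡^ Z (suc (2 ^ e)))) (T≡trace e (Y *P Z))
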